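{- Let $n\geq0$ and $m\geq n+2$. Then for all formulas $\alpha$ and $\beta$, $\neg\circ^m\alpha\vdash_{L_n^{n+1}}\beta$.
   Context: Formulas are built from propositional variables using unary $\neg,\circ$ and binary $\land,\lor,\to$; $\circ^0\alpha=\alpha$, $\circ^{m+1}\alpha=\circ\circ^m\alpha$, $\alpha\leftrightarrow\beta:=(\alpha\to\beta)\land(\beta\to\alpha)$. Logics are Hilbert calculi with modus ponens as only rule and axiom schemas. mbC has the positive classical axioms $\alpha\to(\beta\to\alpha)$; $(\alpha\to\beta)\to((\alpha\to(\beta\to\gamma))\to(\alpha\to\gamma))$; $\alpha\to(\beta\to(\alpha\land\beta))$; $(\alpha\land\beta)\to\alpha$; $(\alpha\land\beta)\to\beta$; $\alpha\to(\alpha\lor\beta)$; $\beta\to(\alpha\lor\beta)$; $(\alpha\to\gamma)\to((\beta\to\gamma)\to((\alpha\lor\beta)\to\gamma))$; $\alpha\lor(\alpha\to\beta)$; plus $\alpha\lor\neg\alpha$ and $\circ\alpha\to(\alpha\to(\neg\alpha\to\beta))$. mbCciw = mbC + $\circ\alpha\lor(\alpha\land\neg\alpha)$. $L_n^0$ = mbCciw + $\circ^{n+2}\alpha$; $L_n^1$ = $L_n^0$ + $\neg\neg\alpha\leftrightarrow\alpha$; for $k\geq2$, $L_n^k$ = $L_n^1$ + (ip$^j$) $\neg\circ^j\neg\alpha\leftrightarrow\neg\circ^j\alpha$ for all $1\leq j<k$. -}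

module Defs where

open import Data.Nat using (ℕ; zero; suc; _+_; _≤_; _<_)
open import Relation.Binary.PropositionalEquality using (_≡_)

infixr 20 ¬'_ ∘'_
infixl 19 _∧'_
infixl 18 _∨'_
infixr 17 _⇒_

data Formula : Set where
  var  : ℕ → Formula
  ¬'_  : Formula → Formula
  ∘'_  : Formula → Formula
  _∧'_ : Formula → Formula → Formula
  _∨'_ : Formula → Formula → Formula
  _⇒_  : Formula → Formula → Formula

∘^ : ℕ → Formula → Formula
∘^ zero    α = α
∘^ (suc m) α = ∘' (∘^ m α)

_⇔_ : Formula → Formula → Formula
α ⇔ β = (α ⇒ β) ∧' (β ⇒ α)

data MbC : Formula → Set where
  ax1  : ∀ α β → MbC (α ⇒ (β ⇒ α))
  ax2  : ∀ α β γ → MbC ((α ⇒ β) ⇒ ((α ⇒ (β ⇒ γ)) ⇒ (α ⇒ γ)))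
  ax3  : ∀ α β → MbC (α ⇒ (β ⇒ (α ∧' β)))
  ax4  : ∀ α β → MbC ((α ∧' β) ⇒ α)
  ax5  : ∀ α β → MbC ((α ∧' β) ⇒ β)
  ax6  : ∀ α β → MbC (α ⇒ (α ∨' β))
  ax7  : ∀ α β → MbC (β ⇒ (α ∨' β))
  ax8  : ∀ α β γ → MbC ((α ⇒ γ) ⇒ ((β ⇒ γ) ⇒ ((α ∨' β) ⇒ γ)))
  ax9  : ∀ α β → MbC (α ∨' (α ⇒ β))
  ax10 : ∀ α → MbC (α ∨' ¬' α)
  bc1  : ∀ α β → MbC (∘' α ⇒ (α ⇒ (¬' α ⇒ β)))

data Ax (n k : ℕ) : Formula → Set where
  mbc  : ∀ {φ} → MbC φ → Ax n k φ
  ciw  : ∀ α → Ax n k (∘' α ∨' (α ∧' ¬' α))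
  circ : ∀ α → Ax n k (∘^ (n + 2) α)
  dneg : ∀ α → 1 ≤ k → Ax n k ((¬' ¬' α) ⇔ α)
  ip   : ∀ j α → 1 ≤ j → j < k → Ax n k ((¬' ∘^ j (¬' α)) ⇔ (¬' ∘^ j α))

data _⊢[_,_]_ (Γ : Formula → Set) (n k : ℕ) : Formula → Set where
  hyp : ∀ {φ} → Γ φ → Γ ⊢[ n , k ] φ
  ax  : ∀ {φ} → Ax n k φ → Γ ⊢[ n , k ] φ
  mp  : ∀ {φ ψ} → Γ ⊢[ n , k ] φ → Γ ⊢[ n , k ] (φ ⇒ ψ) → Γ ⊢[ n , k ] ψ

⟦_⟧ : Formula → Formula → Set
⟦ γ ⟧ φ = φ ≡ γ

{-# OPTIONS --safe #-}
module Submission where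

-- Since m ≥ n + 2, both ∘^m α and ∘^(m+1) α = ∘(∘^m α) are instances of the
-- axiom ∘^(n+2) γ; so ∘^m α is a theorem together with its own consistency,
-- and gentle explosion (bc1) trivialises the premise ¬∘^m α.

open import Defs
open import Data.Nat using (ℕ; zero; suc; _+_; _≤_)
open import Data.Nat.Properties using (m≤n⇒∃[o]m+o≡n; m≤n⇒m≤1+n)
open import Data.Product using (_,_)
open import Relation.Binary.PropositionalEquality using (_≡_; refl; sym; cong; subst)

∘^-+ : ∀ a b α → ∘^ (a + b) α ≡ ∘^ a (∘^ b α)
∘^-+ zero    b α = refl
∘^-+ (suc a) b α = cong ∘'_ (∘^-+ a b α)

⊢∘^ : ∀ {Γ n k m} → n + 2 ≤ m → ∀ α → Γ ⊢[ n , k ] ∘^ m α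
⊢∘^ {Γ} {n} {k} n+2≤m α with m≤n⇒∃[o]m+o≡n n+2≤m
... | d , refl = subst (Γ ⊢[ n , k ]_) (sym (∘^-+ (n + 2) d α)) (ax (circ (∘^ d α)))

⊢-gentle-explosion : ∀ {Γ n k φ} ψ →
  Γ ⊢[ n , k ] (∘' φ) → Γ ⊢[ n , k ] φ → Γ ⊢[ n , k ] (¬' φ) → Γ ⊢[ n , k ] ψ
⊢-gentle-explosion ψ ⊢∘φ ⊢φ ⊢¬φ = mp ⊢¬φ (mp ⊢φ (mp ⊢∘φ (ax (mbc (bc1 _ ψ)))))

lemma3 : ∀ (n m : ℕ) → n + 2 ≤ m → ∀ (α β : Formula) →
             ⟦ ¬' ∘^ m α ⟧ ⊢[ n , suc n ] β
lemma3 n m n+2≤m α β =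
  ⊢-gentle-explosion β (⊢∘^ (m≤n⇒m≤1+n n+2≤m) α) (⊢∘^ n+2≤m α) (hyp refl)
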